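{- Let $n\ge1$ and let $m_1,\dots,m_n\ge1$ be integers. For indices $k_1,\dots,k_n\ge1$ write $K_j=2(k_1+\cdots+k_j)$ and $M_j=2(m_1+\cdots+m_j)$ (with $M_0=0$), and let $M=m_1+\cdots+m_n$. Then $$\sum_{k_n\ge1}\cdots\sum_{k_1\ge1}\ \prod_{j=1}^{n}\frac{\prod_{i=1}^{m_j}q^{K_j+M_{j-1}+2i}}{\prod_{i=0}^{m_j}(1+q^{K_j+M_{j-1}+2i+1})}=\frac{\prod_{i=1}^{M}q^{2i}}{\prod_{i=1}^{M}(1+q^{2i+1})}\prod_{j=1}^{n}\frac{q^{2(m_j+m_{j+1}+\cdots+m_n)}}{1-q^{2(m_j+m_{j+1}+\cdots+m_n)}}.$$
   Context: The identity is understood as an identity of formal power series in $q$ (equivalently, of analytic functions for $|q|<1$). -}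

module Defs where

open import Data.Nat as ℕ using (ℕ; zero; suc; _≡ᵇ_; _∸_)
open import Data.Integer as ℤ using (ℤ; 0ℤ; 1ℤ)
open import Data.Bool using (if_then_else_)
open import Data.List as List using (List; []; _∷_; upTo; take; drop; zipWith; foldr)
open import Data.Vec as Vec using (Vec; lookup; allFin; toList; _∷ʳ_)
import Data.Nat.ListAction as ListAction
open import Data.Fin using (Fin; toℕ)
open import Relation.Binary.PropositionalEquality using (_≡_)

-- Formal power series in q with integer coefficients:
-- a series is its coefficient function (coefficient of q^N).

PS : Set
PS = ℕ → ℤ

infix 4 _≈ₚ_
_≈ₚ_ : PS → PS → Set
f ≈ₚ g = ∀ N → f N ≡ g N

sumℤ : List ℤ → ℤ
sumℤ = foldr ℤ._+_ 0ℤ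

q^ : ℕ → PS
q^ a N = if a ≡ᵇ N then 1ℤ else 0ℤ

oneₚ : PS
oneₚ = q^ 0

infixl 6 _⊕_ _⊖_
infixl 7 _⊗_

_⊕_ : PS → PS → PS
(f ⊕ g) N = f N ℤ.+ g N

_⊖_ : PS → PS → PS
(f ⊖ g) N = f N ℤ.- g N

_⊗_ : PS → PS → PS
(f ⊗ g) N = sumℤ (List.map (λ i → f i ℤ.* g (N ∸ i)) (upTo (suc N)))

∏ₚ : List PS → PS
∏ₚ = foldr _⊗_ oneₚ

-- Multiplicative inverse of a series with constant term 1
-- (all series inverted below have constant term 1; the constant
-- term of the argument is taken to be 1).  g 0 = 1 and
-- g N = - Σ_{i=1}^{N} f i * g (N - i).
-- invL f N = [g N, g (N-1), ..., g 0].
invL : PS → ℕ → List ℤ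
invL f zero = 1ℤ ∷ []
invL f (suc N) =
  ℤ.- sumℤ (zipWith ℤ._*_ (List.map (λ i → f (suc i)) (upTo (suc N))) (invL f N))
  ∷ invL f N

headℤ : List ℤ → ℤ
headℤ [] = 0ℤ
headℤ (x ∷ _) = x

invₚ : PS → PS
invₚ f N = headℤ (invL f N)

_⊘_ : PS → PS → PS
f ⊘ g = f ⊗ invₚ g

-- Σ_{k ≥ 1} F k, coefficientwise.  Valid (and used only) for families
-- where F k has q-adic valuation > N whenever k > N, so the coefficient
-- of q^N only receives contributions from k = 1, …, N.
sumPos : (ℕ → PS) → PS
sumPos F N = sumℤ (List.map (λ k → F (suc k) N) (upTo N))

-- iterated sum  Σ_{k_n ≥ 1} ⋯ Σ_{k_1 ≥ 1} F (k_1, …, k_n)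
-- (k_n outermost; the vector lists k_1 … k_n in order)
iterSum : (n : ℕ) → (Vec ℕ n → PS) → PS
iterSum zero F = F Vec.[]
iterSum (suc n) F = sumPos (λ k → iterSum n (λ ks → F (ks ∷ʳ k)))

-- Σ_{i=1}^{j} v_i (prefix sums) and Σ_{i=j}^{n} v_i (tail sums), j 1-based
-- given 0-based t = j - 1:  prefix (suc t) = v_1+…+v_j,  suffix t = v_j+…+v_n
prefix : ∀ {n} → Vec ℕ n → ℕ → ℕ
prefix v j = ListAction.sum (take j (toList v))

suffix : ∀ {n} → Vec ℕ n → ℕ → ℕ
suffix v t = ListAction.sum (drop t (toList v))

from1 : ℕ → List ℕ
from1 m = List.map suc (upTo m)

from0 : ℕ → List ℕ
from0 m = upTo (suc m)

-- the j-th factor of the summand (j = t + 1, t = toℕ of the Fin index):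
--   ∏_{i=1}^{m_j} q^{K_j+M_{j-1}+2i} / ∏_{i=0}^{m_j} (1 + q^{K_j+M_{j-1}+2i+1})
-- with K_j = 2(k_1+…+k_j), M_{j-1} = 2(m_1+…+m_{j-1}).
factor : ∀ {n} → Vec ℕ n → Vec ℕ n → Fin n → PS
factor {n} ms ks j =
  ∏ₚ (List.map (λ i → q^ (Kj ℕ.+ Mprev ℕ.+ 2 ℕ.* i)) (from1 mj))
  ⊘ ∏ₚ (List.map (λ i → oneₚ ⊕ q^ (Kj ℕ.+ Mprev ℕ.+ 2 ℕ.* i ℕ.+ 1)) (from0 mj))
  where
    t = toℕ j
    Kj = 2 ℕ.* prefix ks (suc t)
    Mprev = 2 ℕ.* prefix ms t
    mj = lookup ms j

summand : ∀ {n} → Vec ℕ n → Vec ℕ n → PS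
summand {n} ms ks = ∏ₚ (List.map (factor ms ks) (toList (allFin n)))

LHS : (n : ℕ) → Vec ℕ n → PS
LHS n ms = iterSum n (summand ms)

RHS : (n : ℕ) → Vec ℕ n → PS
RHS n ms =
  (∏ₚ (List.map (λ i → q^ (2 ℕ.* i)) (from1 M))
   ⊘ ∏ₚ (List.map (λ i → oneₚ ⊕ q^ (2 ℕ.* i ℕ.+ 1)) (from1 M)))
  ⊗ ∏ₚ (List.map (λ j → q^ (2 ℕ.* suffix ms (toℕ j)) ⊘ (oneₚ ⊖ q^ (2 ℕ.* suffix ms (toℕ j))))
                 (toList (allFin n)))
  where
    M = prefix ms n

{-# OPTIONS --safe #-}
-- Let F(e, m) = ∏_{i=1}^{m} q^{e+2i} / ∏_{i=0}^{m} (1 + q^{e+2i+1}), so that the j-th factor of the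
-- summand is F(K_j + M_{j-1}, m_j), and G(e, m) = ∏_{i=1}^{m} q^{e+2i} / ∏_{i=0}^{m-1} (1 + q^{e+2i+1}).
-- Then F(e, m) (1 − q^{2m}) = G(e, m) − G(e + 2, m), so Σ_{k≥1} F(c + 2k, m) telescopes to
-- G(c + 2, m) / (1 − q^{2m}); moreover F(e, a) G(e + 2a + 2, m) = q^{2m} F(e, a + m).  Summing over
-- k_n, then k_{n-1}, … therefore merges m_n into m_{n-1}, then m_{n-1} + m_n into m_{n-2}, and so on,
-- each step contributing q^{2S} / (1 − q^{2S}) with S = m_j + ⋯ + m_n; the final sum over k_1 leaves
-- G(2, M) / (1 − q^{2M}), and G(2, M) = q^{2M} ∏_{i=1}^{M} q^{2i} / ∏_{i=1}^{M} (1 + q^{2i+1}).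
module Submission where

open import Algebra.Bundles using (CommutativeMonoid; CommutativeRing)
open import Data.Fin as Fin using (Fin; toℕ)
open import Data.Integer as ℤ using (ℤ; 0ℤ; 1ℤ)
import Data.Integer.Properties as ℤP
open import Data.Integer.Solver using (module +-*-Solver)
open import Data.List as List using (applyUpTo; foldr; zipWith; take)
import Data.List.Properties as LP
open import Data.Nat as ℕ using (ℕ; zero; suc; _∸_; _<_; _≤_; s≤s)
import Data.Nat.ListAction as ListAction
import Data.Nat.Properties as ℕP
open import Data.Nat.Tactic.RingSolver using (solve-∀)
open import Data.Product using (_,_)
open import Data.Vec as Vec using (Vec; []; _∷_; _∷ʳ_; toList; lookup; tabulate)
open import Function using (_∘_; id)
open import Level using (0ℓ)
open import Relation.Binary.PropositionalEquality as ≡ using (_≡_; refl; cong; cong₂)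
open import Relation.Nullary using (yes; no)

open import Defs

module BigOperator {c ℓ} (M : CommutativeMonoid c ℓ) where

  open CommutativeMonoid M renaming (refl to ≈-refl)
  open import Algebra.Properties.CommutativeSemigroup commutativeSemigroup using (interchange)

  big : ℕ → (ℕ → Carrier) → Carrier
  big zero    h = ε
  big (suc n) h = h 0 ∙ big n (h ∘ suc)

  big-cong< : ∀ n {h h′ : ℕ → Carrier} → (∀ i → i < n → h i ≈ h′ i) → big n h ≈ big n h′
  big-cong< zero    eq = ≈-refl
  big-cong< (suc n) eq = ∙-cong (eq 0 ℕ.z<s) (big-cong< n (λ i i<n → eq (suc i) (s≤s i<n)))

  big-cong : ∀ n {h h′ : ℕ → Carrier} → (∀ i → h i ≈ h′ i) → big n h ≈ big n h′
  big-cong n eq = big-cong< n (λ i _ → eq i)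

  big-ε : ∀ n {h : ℕ → Carrier} → (∀ i → i < n → h i ≈ ε) → big n h ≈ ε
  big-ε zero    eq = ≈-refl
  big-ε (suc n) eq = trans (∙-cong (eq 0 ℕ.z<s) (big-ε n (λ i i<n → eq (suc i) (s≤s i<n)))) (identityˡ ε)

  big-split : ∀ m n (h : ℕ → Carrier) → big (m ℕ.+ n) h ≈ big m h ∙ big n (λ j → h (m ℕ.+ j))
  big-split zero    n h = sym (identityˡ _)
  big-split (suc m) n h = trans (∙-congˡ (big-split m n (h ∘ suc))) (sym (assoc _ _ _))

  big-snoc : ∀ n (h : ℕ → Carrier) → big (suc n) h ≈ big n h ∙ h n
  big-snoc zero    h = trans (identityʳ _) (sym (identityˡ _))
  big-snoc (suc n) h = trans (∙-congˡ (big-snoc n (h ∘ suc))) (sym (assoc _ _ _))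

  big-distrib : ∀ n (h h′ : ℕ → Carrier) → big n (λ i → h i ∙ h′ i) ≈ big n h ∙ big n h′
  big-distrib zero    h h′ = sym (identityˡ ε)
  big-distrib (suc n) h h′ = trans (∙-congˡ (big-distrib n (h ∘ suc) (h′ ∘ suc))) (interchange _ _ _ _)

  big-swap : ∀ m n (h : ℕ → ℕ → Carrier) → big m (λ i → big n (h i)) ≈ big n (λ j → big m (λ i → h i j))
  big-swap zero    n h = sym (big-ε n (λ _ _ → ≈-refl))
  big-swap (suc m) n h = trans (∙-congˡ (big-swap m n (h ∘ suc))) (sym (big-distrib n (h 0) _))

  foldr-applyUpTo : ∀ (h : ℕ → Carrier) n → foldr _∙_ ε (applyUpTo h n) ≡ big n h
  foldr-applyUpTo h zero    = refl
  foldr-applyUpTo h (suc n) = cong (h 0 ∙_) (foldr-applyUpTo (h ∘ suc) n)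

  foldr-map-applyUpTo : ∀ (h : ℕ → Carrier) g n → foldr _∙_ ε (List.map h (applyUpTo g n)) ≡ big n (h ∘ g)
  foldr-map-applyUpTo h g n = ≡.trans (cong (foldr _∙_ ε) (LP.map-applyUpTo g h n)) (foldr-applyUpTo (h ∘ g) n)

open module ∑ = BigOperator ℤP.+-0-commutativeMonoid using () renaming (big to ∑)

-- A record wrapper keeps Agda from unfolding equalities of series to their
-- pointwise form, which would defeat the inference of implicit arguments.
infix 4 _≋_
record _≋_ (f g : PS) : Set where
  constructor coeffwise
  field coeff : f ≈ₚ g
open _≋_ public

module _ where

  open import Data.Integer using (_+_; _*_; _-_; -_)
  open +-*-Solver using (solve; _:+_; _:*_; _:-_; _:=_; con)

  ∑-*ˡ : ∀ n c (h : ℕ → ℤ) → ∑ n (λ i → c * h i) ≡ c * ∑ n h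
  ∑-*ˡ zero    c h = ≡.sym (ℤP.*-zeroʳ c)
  ∑-*ˡ (suc n) c h = ≡.trans (cong (c * h 0 +_) (∑-*ˡ n c (h ∘ suc))) (≡.sym (ℤP.*-distribˡ-+ c (h 0) _))

  ∑-telescope : ∀ n (a : ℕ → ℤ) → ∑ n (λ k → a k - a (suc k)) ≡ a 0 - a n
  ∑-telescope zero    a = ≡.sym (ℤP.+-inverseʳ (a 0))
  ∑-telescope (suc n) a = ≡.trans (cong (a 0 - a 1 +_) (∑-telescope n (a ∘ suc)))
    (solve 3 (λ x y z → (x :- y) :+ (y :- z) := x :- z) refl (a 0) (a 1) (a (suc n)))

  ∑-zipWith : ∀ n (a b : ℕ → ℤ) → sumℤ (zipWith _*_ (applyUpTo a n) (applyUpTo b n)) ≡ ∑ n (λ i → a i * b i)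
  ∑-zipWith zero    a b = refl
  ∑-zipWith (suc n) a b = cong (a 0 * b 0 +_) (∑-zipWith n (a ∘ suc) (b ∘ suc))

  0ₚ : PS
  0ₚ _ = 0ℤ

  -ₚ_ : PS → PS
  (-ₚ f) N = - f N

  shift : PS → PS
  shift f = f ∘ suc

  infixr 7 _•_
  _•_ : ℤ → PS → PS
  (c • f) N = c * f N

  ⊗-coeff : ∀ f g N → (f ⊗ g) N ≡ ∑ (suc N) (λ i → f i * g (N ∸ i))
  ⊗-coeff f g N = ∑.foldr-map-applyUpTo (λ i → f i * g (N ∸ i)) id (suc N)

  ⊗-coeff-suc : ∀ f g N → (f ⊗ g) (suc N) ≡ f 0 * g (suc N) + (shift f ⊗ g) N
  ⊗-coeff-suc f g N = ≡.trans (⊗-coeff f g (suc N)) (cong (f 0 * g (suc N) +_) (≡.sym (⊗-coeff (shift f) g N)))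

  ⊗-cong : ∀ {f f′ g g′} → f ≈ₚ f′ → g ≈ₚ g′ → f ⊗ g ≈ₚ f′ ⊗ g′
  ⊗-cong {f} {f′} {g} {g′} f≈f′ g≈g′ N = begin
    (f ⊗ g) N                              ≡⟨ ⊗-coeff f g N ⟩
    ∑ (suc N) (λ i → f i * g (N ∸ i))      ≡⟨ ∑.big-cong (suc N) (λ i → cong₂ _*_ (f≈f′ i) (g≈g′ (N ∸ i))) ⟩
    ∑ (suc N) (λ i → f′ i * g′ (N ∸ i))    ≡⟨ ≡.sym (⊗-coeff f′ g′ N) ⟩
    (f′ ⊗ g′) N                            ∎
    where open ≡.≡-Reasoning

  ⊗-comm : ∀ f g → f ⊗ g ≈ₚ g ⊗ f
  ⊗-comm f g N = ≡.trans (⊗-coeff f g N) (≡.trans (comm N f g) (≡.sym (⊗-coeff g f N)))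
    where
    conv : ℕ → PS → PS → ℤ
    conv N f g = ∑ (suc N) (λ i → f i * g (N ∸ i))

    conv-snoc : ∀ N f g → conv (suc N) f g ≡ conv N f (shift g) + f (suc N) * g 0
    conv-snoc N f g = ≡.trans (∑.big-snoc (suc N) (λ i → f i * g (suc N ∸ i)))
      (cong₂ _+_ (∑.big-cong< (suc N) (λ i i≤N → cong (λ j → f i * g j) (ℕP.+-∸-assoc 1 (ℕP.≤-pred i≤N))))
                 (cong (λ j → f (suc N) * g j) (ℕP.n∸n≡0 N)))

    comm : ∀ N f g → conv N f g ≡ conv N g f
    comm zero    f g = cong (_+ 0ℤ) (ℤP.*-comm (f 0) (g 0))
    comm (suc N) f g = begin
      f 0 * g (suc N) + conv N (shift f) g    ≡⟨ cong (f 0 * g (suc N) +_) (comm N (shift f) g) ⟩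
      f 0 * g (suc N) + conv N g (shift f)    ≡⟨ ℤP.+-comm (f 0 * g (suc N)) _ ⟩
      conv N g (shift f) + f 0 * g (suc N)    ≡⟨ cong (conv N g (shift f) +_) (ℤP.*-comm (f 0) (g (suc N))) ⟩
      conv N g (shift f) + g (suc N) * f 0    ≡⟨ ≡.sym (conv-snoc N g f) ⟩
      conv (suc N) g f                        ∎
      where open ≡.≡-Reasoning

  ⊗-distribʳ : ∀ f g h → (g ⊕ h) ⊗ f ≈ₚ g ⊗ f ⊕ h ⊗ f
  ⊗-distribʳ f g h N = begin
    ((g ⊕ h) ⊗ f) N
      ≡⟨ ⊗-coeff (g ⊕ h) f N ⟩
    ∑ (suc N) (λ i → (g i + h i) * f (N ∸ i))
      ≡⟨ ∑.big-cong (suc N) (λ i → ℤP.*-distribʳ-+ (f (N ∸ i)) (g i) (h i)) ⟩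
    ∑ (suc N) (λ i → g i * f (N ∸ i) + h i * f (N ∸ i))
      ≡⟨ ∑.big-distrib (suc N) (λ i → g i * f (N ∸ i)) (λ i → h i * f (N ∸ i)) ⟩
    ∑ (suc N) (λ i → g i * f (N ∸ i)) + ∑ (suc N) (λ i → h i * f (N ∸ i))
      ≡⟨ ≡.sym (cong₂ _+_ (⊗-coeff g f N) (⊗-coeff h f N)) ⟩
    (g ⊗ f ⊕ h ⊗ f) N
      ∎
    where open ≡.≡-Reasoning

  •-⊗ : ∀ c f g → (c • f) ⊗ g ≈ₚ c • (f ⊗ g)
  •-⊗ c f g N = begin
    ((c • f) ⊗ g) N                            ≡⟨ ⊗-coeff (c • f) g N ⟩
    ∑ (suc N) (λ i → c * f i * g (N ∸ i))      ≡⟨ ∑.big-cong (suc N) (λ i → ℤP.*-assoc c (f i) (g (N ∸ i))) ⟩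
    ∑ (suc N) (λ i → c * (f i * g (N ∸ i)))    ≡⟨ ∑-*ˡ (suc N) c (λ i → f i * g (N ∸ i)) ⟩
    c * ∑ (suc N) (λ i → f i * g (N ∸ i))      ≡⟨ cong (c *_) (≡.sym (⊗-coeff f g N)) ⟩
    (c • (f ⊗ g)) N                            ∎
    where open ≡.≡-Reasoning

  -- Comparing coefficients of q^(N+1) reduces associativity for f to associativity for shift f at N.
  ⊗-assoc : ∀ f g h → (f ⊗ g) ⊗ h ≈ₚ f ⊗ (g ⊗ h)
  ⊗-assoc f g h zero =
    solve 3 (λ a b c → (a :* b :+ con 0ℤ) :* c :+ con 0ℤ := a :* (b :* c :+ con 0ℤ) :+ con 0ℤ) refl (f 0) (g 0) (h 0)
  ⊗-assoc f g h (suc N) = begin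
    ((f ⊗ g) ⊗ h) (suc N)
      ≡⟨ ⊗-coeff-suc (f ⊗ g) h N ⟩
    (f ⊗ g) 0 * h (suc N) + (shift (f ⊗ g) ⊗ h) N
      ≡⟨ cong ((f ⊗ g) 0 * h (suc N) +_) (⊗-cong {g = h} (⊗-coeff-suc f g) (λ _ → refl) N) ⟩
    (f ⊗ g) 0 * h (suc N) + ((f 0 • shift g ⊕ shift f ⊗ g) ⊗ h) N
      ≡⟨ cong ((f ⊗ g) 0 * h (suc N) +_) (≡.trans (⊗-distribʳ h (f 0 • shift g) (shift f ⊗ g) N)
                                                   (cong₂ _+_ (•-⊗ (f 0) (shift g) h N) (⊗-assoc (shift f) g h N))) ⟩
    (f 0 * g 0 + 0ℤ) * h (suc N) + (f 0 * (shift g ⊗ h) N + (shift f ⊗ (g ⊗ h)) N)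
      ≡⟨ solve 5 (λ a b c d e → (a :* b :+ con 0ℤ) :* c :+ (a :* d :+ e) := a :* (b :* c :+ d) :+ e)
           refl (f 0) (g 0) (h (suc N)) ((shift g ⊗ h) N) ((shift f ⊗ (g ⊗ h)) N) ⟩
    f 0 * (g 0 * h (suc N) + (shift g ⊗ h) N) + (shift f ⊗ (g ⊗ h)) N
      ≡⟨ cong (λ x → f 0 * x + (shift f ⊗ (g ⊗ h)) N) (≡.sym (⊗-coeff-suc g h N)) ⟩
    f 0 * (g ⊗ h) (suc N) + (shift f ⊗ (g ⊗ h)) N
      ≡⟨ ≡.sym (⊗-coeff-suc f (g ⊗ h) N) ⟩
    (f ⊗ (g ⊗ h)) (suc N)
      ∎
    where open ≡.≡-Reasoning

  ⊗-identityˡ : ∀ f → oneₚ ⊗ f ≈ₚ f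
  ⊗-identityˡ f N = begin
    (oneₚ ⊗ f) N
      ≡⟨ ⊗-coeff oneₚ f N ⟩
    1ℤ * f N + ∑ N (λ i → 0ℤ * f (N ∸ suc i))
      ≡⟨ cong₂ _+_ (ℤP.*-identityˡ (f N)) (∑.big-ε N (λ i _ → ℤP.*-zeroˡ (f (N ∸ suc i)))) ⟩
    f N + 0ℤ
      ≡⟨ ℤP.+-identityʳ (f N) ⟩
    f N
      ∎
    where open ≡.≡-Reasoning

  ⊗-identityʳ : ∀ f → f ⊗ oneₚ ≈ₚ f
  ⊗-identityʳ f N = ≡.trans (⊗-comm f oneₚ N) (⊗-identityˡ f N)

  ⊗-distribˡ : ∀ f g h → f ⊗ (g ⊕ h) ≈ₚ f ⊗ g ⊕ f ⊗ h
  ⊗-distribˡ f g h N = ≡.trans (⊗-comm f (g ⊕ h) N)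
    (≡.trans (⊗-distribʳ f g h N) (cong₂ _+_ (⊗-comm g f N) (⊗-comm h f N)))

  q^-suc-⊗ : ∀ a h N → (q^ (suc a) ⊗ h) (suc N) ≡ (q^ a ⊗ h) N
  q^-suc-⊗ a h N = ≡.trans (⊗-coeff-suc (q^ (suc a)) h N) (ℤP.+-identityˡ ((q^ a ⊗ h) N))

  q^-+ : ∀ a b → q^ a ⊗ q^ b ≋ q^ (a ℕ.+ b)
  q^-+ a b = coeffwise (coeff-eq a)
    where
    coeff-eq : ∀ a → q^ a ⊗ q^ b ≈ₚ q^ (a ℕ.+ b)
    coeff-eq zero    N       = ⊗-identityˡ (q^ b) N
    coeff-eq (suc a) zero    = refl
    coeff-eq (suc a) (suc N) = ≡.trans (q^-suc-⊗ a (q^ b) N) (coeff-eq a N)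

  invL-applyUpTo : ∀ f N → invL f N ≡ applyUpTo (λ i → invₚ f (N ∸ i)) (suc N)
  invL-applyUpTo f zero    = refl
  invL-applyUpTo f (suc N) = cong (invₚ f (suc N) List.∷_) (invL-applyUpTo f N)

  invₚ-suc : ∀ f N → invₚ f (suc N) ≡ - (shift f ⊗ invₚ f) N
  invₚ-suc f N = cong -_ (begin
    sumℤ (zipWith _*_ (List.map (f ∘ suc) (applyUpTo id (suc N))) (invL f N))
      ≡⟨ cong₂ (λ as bs → sumℤ (zipWith _*_ as bs)) (LP.map-applyUpTo id (f ∘ suc) (suc N)) (invL-applyUpTo f N) ⟩
    sumℤ (zipWith _*_ (applyUpTo (f ∘ suc) (suc N)) (applyUpTo (λ i → invₚ f (N ∸ i)) (suc N)))
      ≡⟨ ∑-zipWith (suc N) (f ∘ suc) (λ i → invₚ f (N ∸ i)) ⟩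
    ∑ (suc N) (λ i → f (suc i) * invₚ f (N ∸ i))
      ≡⟨ ≡.sym (⊗-coeff (shift f) (invₚ f) N) ⟩
    (shift f ⊗ invₚ f) N
      ∎)
    where open ≡.≡-Reasoning

  ⊗-invₚ : ∀ f → f 0 ≡ 1ℤ → f ⊗ invₚ f ≋ oneₚ
  ⊗-invₚ f f₀≡1 = coeffwise coeff-eq
    where
    open ≡.≡-Reasoning
    r : ℕ → ℤ
    r N = (shift f ⊗ invₚ f) N
    coeff-eq : f ⊗ invₚ f ≈ₚ oneₚ
    coeff-eq zero    = cong (λ c → c * 1ℤ + 0ℤ) f₀≡1
    coeff-eq (suc N) = begin
      (f ⊗ invₚ f) (suc N)        ≡⟨ ⊗-coeff-suc f (invₚ f) N ⟩
      f 0 * invₚ f (suc N) + r N  ≡⟨ cong₂ (λ c x → c * x + r N) f₀≡1 (invₚ-suc f N) ⟩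
      1ℤ * - r N + r N            ≡⟨ cong (_+ r N) (ℤP.*-identityˡ (- r N)) ⟩
      - r N + r N                 ≡⟨ ℤP.+-inverseˡ (r N) ⟩
      0ℤ                          ∎

  invL-cong : ∀ {f g} → f ≈ₚ g → ∀ N → invL f N ≡ invL g N
  invL-cong f≈g zero    = refl
  invL-cong f≈g (suc N) = cong₂ List._∷_
    (cong₂ (λ as bs → - sumℤ (zipWith _*_ as bs))
           (LP.map-cong (λ i → f≈g (suc i)) (List.upTo (suc N))) (invL-cong f≈g N))
    (invL-cong f≈g N)

  invₚ-cong : ∀ {f g} → f ≋ g → invₚ f ≋ invₚ g
  invₚ-cong (coeffwise f≈g) = coeffwise (λ N → cong headℤ (invL-cong f≈g N))

  Ord≥ : ℕ → PS → Set
  Ord≥ v f = ∀ i → i < v → f i ≡ 0ℤ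

  Ord≥-q^ : ∀ a → Ord≥ a (q^ a)
  Ord≥-q^ (suc a) zero    _         = refl
  Ord≥-q^ (suc a) (suc i) (s≤s i<a) = Ord≥-q^ a i i<a

  Ord≥-⊗ : ∀ {a b f g} → Ord≥ a f → Ord≥ b g → Ord≥ (a ℕ.+ b) (f ⊗ g)
  Ord≥-⊗ {a} {b} {f} {g} ord-f ord-g N N<a+b = ≡.trans (⊗-coeff f g N) (∑.big-ε (suc N) term)
    where
    term : ∀ i → i < suc N → f i * g (N ∸ i) ≡ 0ℤ
    term i i<1+N with i ℕ.<? a
    ... | yes i<a = ≡.trans (cong (_* g (N ∸ i)) (ord-f i i<a)) (ℤP.*-zeroˡ (g (N ∸ i)))
    ... | no  i≮a = ≡.trans (cong (f i *_) (ord-g (N ∸ i) N∸i<b)) (ℤP.*-zeroʳ (f i))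
      where
      a+[N∸i]≤N : a ℕ.+ (N ∸ i) ≤ N
      a+[N∸i]≤N = ℕP.≤-trans (ℕP.+-monoˡ-≤ (N ∸ i) (ℕP.≮⇒≥ i≮a))
                             (ℕP.≤-reflexive (ℕP.m+[n∸m]≡n (ℕP.≤-pred i<1+N)))
      N∸i<b : N ∸ i < b
      N∸i<b = ℕP.+-cancelˡ-< a (N ∸ i) b (ℕP.≤-<-trans a+[N∸i]≤N N<a+b)

  sumPos-coeff : ∀ F N → sumPos F N ≡ ∑ N (λ k → F (suc k) N)
  sumPos-coeff F N = ∑.foldr-map-applyUpTo (λ k → F (suc k) N) id N

  sumPos-cong : ∀ F G → (∀ k → F (suc k) ≋ G (suc k)) → sumPos F ≋ sumPos G
  sumPos-cong F G F≋G = coeffwise λ N →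
    ≡.trans (sumPos-coeff F N) (≡.trans (∑.big-cong N (λ k → coeff (F≋G k) N)) (≡.sym (sumPos-coeff G N)))

  sumPos-swap : ∀ (H : ℕ → ℕ → PS) → sumPos (λ a → sumPos (H a)) ≋ sumPos (λ b → sumPos (λ a → H a b))
  sumPos-swap H = coeffwise λ N → begin
    sumPos (λ a → sumPos (H a)) N                  ≡⟨ sumPos-coeff (λ a → sumPos (H a)) N ⟩
    ∑ N (λ a → sumPos (H (suc a)) N)               ≡⟨ ∑.big-cong N (λ a → sumPos-coeff (H (suc a)) N) ⟩
    ∑ N (λ a → ∑ N (λ b → H (suc a) (suc b) N))    ≡⟨ ∑.big-swap N N (λ a b → H (suc a) (suc b) N) ⟩
    ∑ N (λ b → ∑ N (λ a → H (suc a) (suc b) N))    ≡⟨ ∑.big-cong N (λ b → ≡.sym (sumPos-coeff (λ a → H a (suc b)) N)) ⟩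
    ∑ N (λ b → sumPos (λ a → H a (suc b)) N)       ≡⟨ ≡.sym (sumPos-coeff (λ b → sumPos (λ a → H a b)) N) ⟩
    sumPos (λ b → sumPos (λ a → H a b)) N          ∎
    where open ≡.≡-Reasoning

  Ord≥-sumPos : ∀ {v} F → (∀ k → Ord≥ v (F (suc k))) → Ord≥ v (sumPos F)
  Ord≥-sumPos F ord i i<v = ≡.trans (sumPos-coeff F i) (∑.big-ε i (λ k _ → ord k i i<v))

  sumPos-truncate : ∀ G → (∀ k → Ord≥ (suc k) (G (suc k))) →
                    ∀ {j N} → j ≤ N → ∑ N (λ k → G (suc k) j) ≡ sumPos G j
  sumPos-truncate G ord {j} {N} j≤N = begin
    ∑ N (λ k → G (suc k) j)
      ≡⟨ cong (λ n → ∑ n (λ k → G (suc k) j)) (≡.sym (ℕP.m+[n∸m]≡n j≤N)) ⟩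
    ∑ (j ℕ.+ (N ∸ j)) (λ k → G (suc k) j)
      ≡⟨ ∑.big-split j (N ∸ j) (λ k → G (suc k) j) ⟩
    ∑ j (λ k → G (suc k) j) + ∑ (N ∸ j) (λ k → G (suc (j ℕ.+ k)) j)
      ≡⟨ cong (∑ j (λ k → G (suc k) j) +_) (∑.big-ε (N ∸ j) (λ k _ → ord (j ℕ.+ k) j (s≤s (ℕP.m≤m+n j k)))) ⟩
    ∑ j (λ k → G (suc k) j) + 0ℤ
      ≡⟨ ℤP.+-identityʳ _ ⟩
    ∑ j (λ k → G (suc k) j)
      ≡⟨ ≡.sym (sumPos-coeff G j) ⟩
    sumPos G j
      ∎
    where open ≡.≡-Reasoning

  sumPos-⊗ˡ : ∀ X G → (∀ k → Ord≥ (suc k) (G (suc k))) → sumPos (λ k → X ⊗ G k) ≋ X ⊗ sumPos G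
  sumPos-⊗ˡ X G ord = coeffwise λ N → begin
    sumPos (λ k → X ⊗ G k) N
      ≡⟨ sumPos-coeff (λ k → X ⊗ G k) N ⟩
    ∑ N (λ k → (X ⊗ G (suc k)) N)
      ≡⟨ ∑.big-cong N (λ k → ⊗-coeff X (G (suc k)) N) ⟩
    ∑ N (λ k → ∑ (suc N) (λ i → X i * G (suc k) (N ∸ i)))
      ≡⟨ ∑.big-swap N (suc N) (λ k i → X i * G (suc k) (N ∸ i)) ⟩
    ∑ (suc N) (λ i → ∑ N (λ k → X i * G (suc k) (N ∸ i)))
      ≡⟨ ∑.big-cong (suc N) (λ i → ∑-*ˡ N (X i) (λ k → G (suc k) (N ∸ i))) ⟩
    ∑ (suc N) (λ i → X i * ∑ N (λ k → G (suc k) (N ∸ i)))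
      ≡⟨ ∑.big-cong (suc N) (λ i → cong (X i *_) (sumPos-truncate G ord (ℕP.m∸n≤m N i))) ⟩
    ∑ (suc N) (λ i → X i * sumPos G (N ∸ i))
      ≡⟨ ≡.sym (⊗-coeff X (sumPos G) N) ⟩
    (X ⊗ sumPos G) N
      ∎
    where open ≡.≡-Reasoning

  sumPos-telescope : ∀ (g : ℕ → PS) → (∀ k → Ord≥ k (g k)) → sumPos (λ k → g k ⊖ g (suc k)) ≋ g 1
  sumPos-telescope g ord = coeffwise λ N → begin
    sumPos (λ k → g k ⊖ g (suc k)) N               ≡⟨ sumPos-coeff (λ k → g k ⊖ g (suc k)) N ⟩
    ∑ N (λ k → g (suc k) N - g (suc (suc k)) N)    ≡⟨ ∑-telescope N (λ k → g (suc k) N) ⟩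
    g 1 N - g (suc N) N                            ≡⟨ cong (λ x → g 1 N - x) (ord (suc N) N ℕP.≤-refl) ⟩
    g 1 N - 0ℤ                                     ≡⟨ ℤP.+-identityʳ (g 1 N) ⟩
    g 1 N                                          ∎
    where open ≡.≡-Reasoning

  ⊕-⊖-⊕ : ∀ f g h → (f ⊕ h) ⊖ (g ⊕ h) ≋ f ⊖ g
  ⊕-⊖-⊕ f g h = coeffwise λ N → solve 3 (λ a b c → (a :+ c) :- (b :+ c) := a :- b) refl (f N) (g N) (h N)

PS-commutativeRing : CommutativeRing 0ℓ 0ℓ
PS-commutativeRing = record
  { Carrier           = PS
  ; _≈_               = _≋_
  ; _+_               = _⊕_
  ; _*_               = _⊗_
  ; -_                = -ₚ_
  ; 0#                = 0ₚ
  ; 1#                = oneₚ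
  ; isCommutativeRing = record
    { isRing = record
      { +-isAbelianGroup = record
        { isGroup = record
          { isMonoid = record
            { isSemigroup = record
              { isMagma = record
                { isEquivalence = record
                  { refl  = coeffwise (λ _ → refl)
                  ; sym   = λ (coeffwise f≈g) → coeffwise (λ N → ≡.sym (f≈g N))
                  ; trans = λ (coeffwise f≈g) (coeffwise g≈h) → coeffwise (λ N → ≡.trans (f≈g N) (g≈h N))
                  }
                ; ∙-cong = λ (coeffwise f≈f′) (coeffwise g≈g′) → coeffwise (λ N → cong₂ ℤ._+_ (f≈f′ N) (g≈g′ N))
                }
              ; assoc = λ f g h → coeffwise (λ N → ℤP.+-assoc (f N) (g N) (h N))
              }
            ; identity = (λ f → coeffwise (λ N → ℤP.+-identityˡ (f N))) , (λ f → coeffwise (λ N → ℤP.+-identityʳ (f N)))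
            }
          ; inverse = (λ f → coeffwise (λ N → ℤP.+-inverseˡ (f N))) , (λ f → coeffwise (λ N → ℤP.+-inverseʳ (f N)))
          ; ⁻¹-cong = λ (coeffwise f≈g) → coeffwise (λ N → cong ℤ.-_ (f≈g N))
          }
        ; comm = λ f g → coeffwise (λ N → ℤP.+-comm (f N) (g N))
        }
      ; *-cong     = λ (coeffwise f≈f′) (coeffwise g≈g′) → coeffwise (⊗-cong f≈f′ g≈g′)
      ; *-assoc    = λ f g h → coeffwise (⊗-assoc f g h)
      ; *-identity = (λ f → coeffwise (⊗-identityˡ f)) , (λ f → coeffwise (⊗-identityʳ f))
      ; distrib    = (λ f g h → coeffwise (⊗-distribˡ f g h)) , (λ f g h → coeffwise (⊗-distribʳ f g h))
      }
    ; *-comm = λ f g → coeffwise (⊗-comm f g)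
    }
  }

module PS = CommutativeRing PS-commutativeRing
open import Algebra.Properties.CommutativeSemigroup PS.*-commutativeSemigroup
  using (interchange; xy∙z≈yz∙x; x∙yz≈y∙xz; x∙yz≈yx∙z)
open import Algebra.Properties.Ring PS.ring using ([y-z]x≈yx-zx)
open import Relation.Binary.Reasoning.Setoid PS.setoid
open import Data.Nat using (_+_; _*_)

⊗-constant : ∀ f g → f 0 ≡ 1ℤ → g 0 ≡ 1ℤ → (f ⊗ g) 0 ≡ 1ℤ
⊗-constant f g f₀≡1 g₀≡1 = cong₂ (λ a b → a ℤ.* b ℤ.+ 0ℤ) f₀≡1 g₀≡1

invₚ-unique : ∀ f {g} → f 0 ≡ 1ℤ → f ⊗ g ≋ oneₚ → g ≋ invₚ f
invₚ-unique f {g} f₀≡1 fg≋1 = begin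
  g                   ≈⟨ PS.sym (PS.*-identityʳ g) ⟩
  g ⊗ oneₚ            ≈⟨ PS.*-congˡ {g} (PS.sym (⊗-invₚ f f₀≡1)) ⟩
  g ⊗ (f ⊗ invₚ f)    ≈⟨ x∙yz≈y∙xz g f (invₚ f) ⟩
  f ⊗ (g ⊗ invₚ f)    ≈⟨ PS.sym (PS.*-assoc f g (invₚ f)) ⟩
  (f ⊗ g) ⊗ invₚ f    ≈⟨ PS.*-congʳ {invₚ f} fg≋1 ⟩
  oneₚ ⊗ invₚ f       ≈⟨ PS.*-identityˡ (invₚ f) ⟩
  invₚ f              ∎

invₚ-⊗ : ∀ f g → f 0 ≡ 1ℤ → g 0 ≡ 1ℤ → invₚ (f ⊗ g) ≋ invₚ f ⊗ invₚ g
invₚ-⊗ f g f₀≡1 g₀≡1 = PS.sym (invₚ-unique (f ⊗ g) (⊗-constant f g f₀≡1 g₀≡1) (begin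
  (f ⊗ g) ⊗ (invₚ f ⊗ invₚ g)    ≈⟨ interchange f g (invₚ f) (invₚ g) ⟩
  (f ⊗ invₚ f) ⊗ (g ⊗ invₚ g)    ≈⟨ PS.*-cong (⊗-invₚ f f₀≡1) (⊗-invₚ g g₀≡1) ⟩
  oneₚ ⊗ oneₚ                    ≈⟨ PS.*-identityˡ oneₚ ⟩
  oneₚ                           ∎))

⊘-⊗-⊘ : ∀ a b c d → b 0 ≡ 1ℤ → d 0 ≡ 1ℤ → (a ⊘ b) ⊗ (c ⊘ d) ≋ (a ⊗ c) ⊘ (b ⊗ d)
⊘-⊗-⊘ a b c d b₀≡1 d₀≡1 = begin
  (a ⊗ invₚ b) ⊗ (c ⊗ invₚ d)    ≈⟨ interchange a (invₚ b) c (invₚ d) ⟩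
  (a ⊗ c) ⊗ (invₚ b ⊗ invₚ d)    ≈⟨ PS.*-congˡ {a ⊗ c} (PS.sym (invₚ-⊗ b d b₀≡1 d₀≡1)) ⟩
  (a ⊗ c) ⊗ invₚ (b ⊗ d)         ∎

⊗-⊘-cancel : ∀ a b c → b 0 ≡ 1ℤ → c 0 ≡ 1ℤ → (a ⊗ c) ⊘ (b ⊗ c) ≋ a ⊘ b
⊗-⊘-cancel a b c b₀≡1 c₀≡1 = begin
  (a ⊗ c) ⊗ invₚ (b ⊗ c)         ≈⟨ PS.sym (⊘-⊗-⊘ a b c c b₀≡1 c₀≡1) ⟩
  (a ⊗ invₚ b) ⊗ (c ⊗ invₚ c)    ≈⟨ PS.*-congˡ {a ⊗ invₚ b} (⊗-invₚ c c₀≡1) ⟩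
  (a ⊗ invₚ b) ⊗ oneₚ            ≈⟨ PS.*-identityʳ (a ⊗ invₚ b) ⟩
  a ⊗ invₚ b                     ∎

⊘-intro : ∀ {x a} d → d 0 ≡ 1ℤ → x ⊗ d ≋ a → x ≋ a ⊘ d
⊘-intro {x} {a} d d₀≡1 xd≋a = begin
  x                   ≈⟨ PS.sym (PS.*-identityʳ x) ⟩
  x ⊗ oneₚ            ≈⟨ PS.*-congˡ {x} (PS.sym (⊗-invₚ d d₀≡1)) ⟩
  x ⊗ (d ⊗ invₚ d)    ≈⟨ PS.sym (PS.*-assoc x d (invₚ d)) ⟩
  (x ⊗ d) ⊗ invₚ d    ≈⟨ PS.*-congʳ {invₚ d} xd≋a ⟩
  a ⊗ invₚ d          ∎

Ord≥-≤ : ∀ {a b f} → a ≤ b → Ord≥ b f → Ord≥ a f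
Ord≥-≤ a≤b ord i i<a = ord i (ℕP.<-≤-trans i<a a≤b)

Ord≥-⊗ˡ : ∀ {a f g} → Ord≥ a f → Ord≥ a (f ⊗ g)
Ord≥-⊗ˡ {a} ord = Ord≥-≤ (ℕP.m≤m+n a 0) (Ord≥-⊗ {b = 0} ord (λ _ ()))

sumPos-⊗ʳ : ∀ G X → (∀ k → Ord≥ (suc k) (G (suc k))) → sumPos (λ k → G k ⊗ X) ≋ sumPos G ⊗ X
sumPos-⊗ʳ G X ord = begin
  sumPos (λ k → G k ⊗ X)    ≈⟨ sumPos-cong (λ k → G k ⊗ X) (λ k → X ⊗ G k) (λ k → PS.*-comm (G (suc k)) X) ⟩
  sumPos (λ k → X ⊗ G k)    ≈⟨ sumPos-⊗ˡ X G ord ⟩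
  X ⊗ sumPos G              ≈⟨ PS.*-comm X (sumPos G) ⟩
  sumPos G ⊗ X              ∎

total : ∀ {n} → Vec ℕ n → ℕ
total v = ListAction.sum (toList v)

iterSum-cong : ∀ n F G → (∀ ks → F ks ≋ G ks) → iterSum n F ≋ iterSum n G
iterSum-cong zero    F G F≋G = F≋G []
iterSum-cong (suc n) F G F≋G =
  sumPos-cong (λ k → iterSum n (λ ks → F (ks ∷ʳ k))) (λ k → iterSum n (λ ks → G (ks ∷ʳ k)))
    (λ k → iterSum-cong n (λ ks → F (ks ∷ʳ suc k)) (λ ks → G (ks ∷ʳ suc k)) (λ ks → F≋G (ks ∷ʳ suc k)))

Ord≥-iterSum : ∀ n {v} F → (∀ ks → Ord≥ v (F ks)) → Ord≥ v (iterSum n F)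
Ord≥-iterSum zero    F ord = ord []
Ord≥-iterSum (suc n) F ord = Ord≥-sumPos (λ k → iterSum n (λ ks → F (ks ∷ʳ k)))
  (λ k → Ord≥-iterSum n (λ ks → F (ks ∷ʳ suc k)) (λ ks → ord (ks ∷ʳ suc k)))

iterSum-peel : ∀ n F → iterSum (suc n) F ≋ sumPos (λ k → iterSum n (λ ks → F (k ∷ ks)))
iterSum-peel zero    F = PS.refl
iterSum-peel (suc n) F = begin
  sumPos (λ y → iterSum (suc n) (λ ks → F (ks ∷ʳ y)))
    ≈⟨ sumPos-cong (λ y → iterSum (suc n) (λ ks → F (ks ∷ʳ y))) (λ y → sumPos (λ k → H y k))
                   (λ y → iterSum-peel n (λ ks → F (ks ∷ʳ suc y))) ⟩
  sumPos (λ y → sumPos (λ k → H y k))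
    ≈⟨ sumPos-swap H ⟩
  sumPos (λ k → sumPos (λ y → H y k))
    ∎
  where
  H : ℕ → ℕ → PS
  H y k = iterSum n (λ ks → F ((k ∷ ks) ∷ʳ y))

iterSum-⊗ˡ : ∀ n X G → (∀ ks → Ord≥ (total ks) (G ks)) → iterSum n (λ ks → X ⊗ G ks) ≋ X ⊗ iterSum n G
iterSum-⊗ˡ zero    X G ord = PS.refl
iterSum-⊗ˡ (suc n) X G ord = begin
  iterSum (suc n) (λ ks → X ⊗ G ks)
    ≈⟨ iterSum-peel n (λ ks → X ⊗ G ks) ⟩
  sumPos (λ k → iterSum n (λ ks → X ⊗ G (k ∷ ks)))
    ≈⟨ sumPos-cong (λ k → iterSum n (λ ks → X ⊗ G (k ∷ ks))) (λ k → X ⊗ Gₖ k)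
                   (λ k → iterSum-⊗ˡ n X (λ ks → G (suc k ∷ ks)) (ord-tail k)) ⟩
  sumPos (λ k → X ⊗ Gₖ k)
    ≈⟨ sumPos-⊗ˡ X Gₖ ord-Gₖ ⟩
  X ⊗ sumPos Gₖ
    ≈⟨ PS.*-congˡ {X} (PS.sym (iterSum-peel n G)) ⟩
  X ⊗ iterSum (suc n) G
    ∎
  where
  Gₖ : ℕ → PS
  Gₖ k = iterSum n (λ ks → G (k ∷ ks))
  ord-tail : ∀ k ks → Ord≥ (total ks) (G (suc k ∷ ks))
  ord-tail k ks = Ord≥-≤ (ℕP.m≤n+m (total ks) (suc k)) (ord (suc k ∷ ks))
  ord-Gₖ : ∀ k → Ord≥ (suc k) (Gₖ (suc k))
  ord-Gₖ k = Ord≥-iterSum n (λ ks → G (suc k ∷ ks)) (λ ks → Ord≥-≤ (ℕP.m≤m+n (suc k) (total ks)) (ord (suc k ∷ ks)))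

open module ∏ = BigOperator PS.*-commutativeMonoid using () renaming (big to ∏)

∏-q^ : ∀ n d → ∏ n (λ _ → q^ d) ≋ q^ (n * d)
∏-q^ zero    d = PS.refl
∏-q^ (suc n) d = PS.trans (PS.*-congˡ {q^ d} (∏-q^ n d)) (q^-+ d (n * d))

∏-constant : ∀ n h → (∀ i → h i 0 ≡ 1ℤ) → ∏ n h 0 ≡ 1ℤ
∏-constant zero    h h₀≡1 = refl
∏-constant (suc n) h h₀≡1 = ⊗-constant (h 0) (∏ n (h ∘ suc)) (h₀≡1 0) (∏-constant n (h ∘ suc) (h₀≡1 ∘ suc))

-- numer e m = ∏_{i=1}^{m} q^{e+2i} and denom e m = ∏_{i=0}^{m-1} (1 + q^{e+2i+1});
-- factorₚ and antidifference are the F and G above.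
numer : ℕ → ℕ → PS
numer e m = ∏ m (λ i → q^ (e + 2 * suc i))

denom : ℕ → ℕ → PS
denom e m = ∏ m (λ i → oneₚ ⊕ q^ (e + 2 * i + 1))

factorₚ : ℕ → ℕ → PS
factorₚ e m = numer e m ⊘ denom e (suc m)

antidifference : ℕ → ℕ → PS
antidifference e m = numer e m ⊘ denom e m

geometric : ℕ → PS
geometric s = q^ (2 * s) ⊘ (oneₚ ⊖ q^ (2 * s))

numer-shift : ∀ e m → numer (e + 2) m ≋ q^ (2 * m) ⊗ numer e m
numer-shift e m = begin
  ∏ m (λ i → q^ (e + 2 + 2 * suc i))
    ≈⟨ ∏.big-cong m (λ i → PS.sym (PS.trans (q^-+ 2 (e + 2 * suc i)) (PS.reflexive (cong q^ (exponent e i))))) ⟩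
  ∏ m (λ i → q^ 2 ⊗ q^ (e + 2 * suc i))
    ≈⟨ ∏.big-distrib m (λ _ → q^ 2) (λ i → q^ (e + 2 * suc i)) ⟩
  ∏ m (λ _ → q^ 2) ⊗ numer e m
    ≈⟨ PS.*-congʳ {numer e m} (∏-q^ m 2) ⟩
  q^ (m * 2) ⊗ numer e m
    ≡⟨ cong (λ d → q^ d ⊗ numer e m) (ℕP.*-comm m 2) ⟩
  q^ (2 * m) ⊗ numer e m
    ∎
  where
  exponent : ∀ e i → 2 + (e + 2 * suc i) ≡ e + 2 + 2 * suc i
  exponent = solve-∀

numer-split : ∀ e a b → numer e (a + b) ≋ numer e a ⊗ numer (e + 2 * a) b
numer-split e a b = PS.trans (∏.big-split a b (λ i → q^ (e + 2 * suc i)))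
  (PS.*-congˡ {numer e a} (∏.big-cong b (λ j → PS.reflexive (cong q^ (exponent e a j)))))
  where
  exponent : ∀ e a j → e + 2 * suc (a + j) ≡ e + 2 * a + 2 * suc j
  exponent = solve-∀

denom-split : ∀ e a b → denom e (a + b) ≋ denom e a ⊗ denom (e + 2 * a) b
denom-split e a b = PS.trans (∏.big-split a b (λ i → oneₚ ⊕ q^ (e + 2 * i + 1)))
  (PS.*-congˡ {denom e a} (∏.big-cong b (λ j → PS.reflexive (cong (λ d → oneₚ ⊕ q^ d) (exponent e a j)))))
  where
  exponent : ∀ e a j → e + 2 * (a + j) + 1 ≡ e + 2 * a + 2 * j + 1
  exponent = solve-∀

denom-snoc : ∀ e m → denom e (suc m) ≋ denom e m ⊗ (oneₚ ⊕ q^ (e + 2 * m + 1))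
denom-snoc e m = ∏.big-snoc m (λ i → oneₚ ⊕ q^ (e + 2 * i + 1))

denom-cons : ∀ e m → denom e (suc m) ≋ (oneₚ ⊕ q^ (e + 1)) ⊗ denom (e + 2) m
denom-cons e m = PS.*-cong (PS.reflexive (cong (λ d → oneₚ ⊕ q^ d) (exponent₀ e)))
                           (∏.big-cong m (λ i → PS.reflexive (cong (λ d → oneₚ ⊕ q^ d) (exponent e i))))
  where
  exponent₀ : ∀ e → e + 2 * 0 + 1 ≡ e + 1
  exponent₀ = solve-∀
  exponent : ∀ e i → e + 2 * suc i + 1 ≡ e + 2 + 2 * i + 1
  exponent = solve-∀

1+q^-constant : ∀ a → (oneₚ ⊕ q^ (a + 1)) 0 ≡ 1ℤ
1+q^-constant a rewrite ℕP.+-comm a 1 = refl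

denom-constant : ∀ e m → denom e m 0 ≡ 1ℤ
denom-constant e m = ∏-constant m (λ i → oneₚ ⊕ q^ (e + 2 * i + 1)) (λ i → 1+q^-constant (e + 2 * i))

Ord≥-numer : ∀ e m → Ord≥ (e + 2) (numer e (suc m))
Ord≥-numer e m = Ord≥-⊗ˡ (Ord≥-q^ (e + 2))

Ord≥-factorₚ : ∀ e m → Ord≥ (e + 2) (factorₚ e (suc m))
Ord≥-factorₚ e m = Ord≥-⊗ˡ (Ord≥-numer e m)

Ord≥-antidifference : ∀ e m → Ord≥ (e + 2) (antidifference e (suc m))
Ord≥-antidifference e m = Ord≥-⊗ˡ (Ord≥-numer e m)

antidifference-as-factorₚ : ∀ e m → antidifference e m ≋ (oneₚ ⊕ q^ (e + 2 * m + 1)) ⊗ factorₚ e m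
antidifference-as-factorₚ e m = PS.sym (begin
  Y ⊗ (P ⊗ invₚ (denom e (suc m)))    ≈⟨ PS.*-congˡ {Y} (PS.*-congˡ {P} (invₚ-cong (denom-snoc e m))) ⟩
  Y ⊗ (P ⊗ invₚ (D ⊗ Y))              ≈⟨ x∙yz≈yx∙z Y P (invₚ (D ⊗ Y)) ⟩
  (P ⊗ Y) ⊗ invₚ (D ⊗ Y)              ≈⟨ ⊗-⊘-cancel P D Y (denom-constant e m) (1+q^-constant (e + 2 * m)) ⟩
  P ⊗ invₚ D                          ∎)
  where
  P = numer e m
  D = denom e m
  Y = oneₚ ⊕ q^ (e + 2 * m + 1)

antidifference+2-as-factorₚ : ∀ e m → antidifference (e + 2) m ≋ (q^ (2 * m) ⊕ q^ (e + 2 * m + 1)) ⊗ factorₚ e m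
antidifference+2-as-factorₚ e m = PS.sym (begin
  (x ⊕ y) ⊗ (P ⊗ invₚ (denom e (suc m)))
    ≈⟨ PS.*-cong x⊕y≋x⊗Z (PS.*-congˡ {P} (invₚ-cong (PS.trans (denom-cons e m) (PS.*-comm Z D)))) ⟩
  (x ⊗ Z) ⊗ (P ⊗ invₚ (D ⊗ Z))
    ≈⟨ interchange x Z P (invₚ (D ⊗ Z)) ⟩
  (x ⊗ P) ⊗ (Z ⊗ invₚ (D ⊗ Z))
    ≈⟨ PS.sym (PS.*-assoc (x ⊗ P) Z (invₚ (D ⊗ Z))) ⟩
  ((x ⊗ P) ⊗ Z) ⊗ invₚ (D ⊗ Z)
    ≈⟨ ⊗-⊘-cancel (x ⊗ P) D Z (denom-constant (e + 2) m) (1+q^-constant e) ⟩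
  (x ⊗ P) ⊗ invₚ D
    ≈⟨ PS.*-congʳ {invₚ D} (PS.sym (numer-shift e m)) ⟩
  numer (e + 2) m ⊗ invₚ D
    ∎)
  where
  P = numer e m
  D = denom (e + 2) m
  x = q^ (2 * m)
  y = q^ (e + 2 * m + 1)
  Z = oneₚ ⊕ q^ (e + 1)
  exponent : ∀ e m → 2 * m + (e + 1) ≡ e + 2 * m + 1
  exponent = solve-∀
  x⊕y≋x⊗Z : x ⊕ y ≋ x ⊗ Z
  x⊕y≋x⊗Z = PS.sym (begin
    x ⊗ (oneₚ ⊕ q^ (e + 1))      ≈⟨ PS.distribˡ x oneₚ (q^ (e + 1)) ⟩
    x ⊗ oneₚ ⊕ x ⊗ q^ (e + 1)    ≈⟨ PS.+-cong (PS.*-identityʳ x) (q^-+ (2 * m) (e + 1)) ⟩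
    x ⊕ q^ (2 * m + (e + 1))     ≡⟨ cong (λ d → x ⊕ q^ d) (exponent e m) ⟩
    x ⊕ y                        ∎)

factorₚ-telescopes : ∀ e m → factorₚ e m ⊗ (oneₚ ⊖ q^ (2 * m)) ≋ antidifference e m ⊖ antidifference (e + 2) m
factorₚ-telescopes e m = begin
  F ⊗ (oneₚ ⊖ x)                   ≈⟨ PS.*-comm F (oneₚ ⊖ x) ⟩
  (oneₚ ⊖ x) ⊗ F                   ≈⟨ PS.*-congʳ {F} (PS.sym (⊕-⊖-⊕ oneₚ x y)) ⟩
  ((oneₚ ⊕ y) ⊖ (x ⊕ y)) ⊗ F       ≈⟨ [y-z]x≈yx-zx F (oneₚ ⊕ y) (x ⊕ y) ⟩
  (oneₚ ⊕ y) ⊗ F ⊖ (x ⊕ y) ⊗ F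
    ≈⟨ PS.sym (PS.+-cong (antidifference-as-factorₚ e m) (PS.-‿cong (antidifference+2-as-factorₚ e m))) ⟩
  antidifference e m ⊖ antidifference (e + 2) m
    ∎
  where
  F = factorₚ e m
  x = q^ (2 * m)
  y = q^ (e + 2 * m + 1)

k≤c+2k+2 : ∀ c k → k ≤ c + 2 * k + 2
k≤c+2k+2 c k = ℕP.≤-trans (ℕP.m≤n*m k 2) (ℕP.≤-trans (ℕP.m≤n+m (2 * k) c) (ℕP.m≤m+n (c + 2 * k) 2))

sumPos-factorₚ : ∀ c m →
  sumPos (λ k → factorₚ (c + 2 * k) (suc m)) ≋ antidifference (c + 2) (suc m) ⊘ (oneₚ ⊖ q^ (2 * suc m))
sumPos-factorₚ c m = ⊘-intro Q refl (begin
  sumPos F ⊗ Q                      ≈⟨ PS.sym (sumPos-⊗ʳ F Q ord-F) ⟩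
  sumPos (λ k → F k ⊗ Q)            ≈⟨ sumPos-cong (λ k → F k ⊗ Q) (λ k → g k ⊖ g (suc k)) F⊗Q≋Δg ⟩
  sumPos (λ k → g k ⊖ g (suc k))    ≈⟨ sumPos-telescope g ord-g ⟩
  g 1                               ∎)
  where
  M = suc m
  Q = oneₚ ⊖ q^ (2 * M)
  F g : ℕ → PS
  F k = factorₚ (c + 2 * k) M
  g k = antidifference (c + 2 * k) M
  exponent : ∀ c k → c + 2 * suc k + 2 ≡ c + 2 * suc (suc k)
  exponent = solve-∀
  F⊗Q≋Δg : ∀ k → F (suc k) ⊗ Q ≋ g (suc k) ⊖ g (suc (suc k))
  F⊗Q≋Δg k = PS.trans (factorₚ-telescopes (c + 2 * suc k) M)
                      (PS.reflexive (cong (λ e → g (suc k) ⊖ antidifference e M) (exponent c k)))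
  ord-F : ∀ k → Ord≥ (suc k) (F (suc k))
  ord-F k = Ord≥-≤ (k≤c+2k+2 c (suc k)) (Ord≥-factorₚ (c + 2 * suc k) m)
  ord-g : ∀ k → Ord≥ k (g k)
  ord-g k = Ord≥-≤ (k≤c+2k+2 c k) (Ord≥-antidifference (c + 2 * k) m)

factorₚ-⊗-antidifference : ∀ e a m →
  factorₚ e a ⊗ antidifference (e + 2 * a + 2) m ≋ factorₚ e (a + m) ⊗ q^ (2 * m)
factorₚ-⊗-antidifference e a m = begin
  (P₁ ⊗ invₚ D₁) ⊗ (P₂ ⊗ invₚ D₂)
    ≈⟨ ⊘-⊗-⊘ P₁ D₁ P₂ D₂ (denom-constant e (suc a)) (denom-constant (e + 2 * a + 2) m) ⟩
  (P₁ ⊗ P₂) ⊗ invₚ (D₁ ⊗ D₂)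
    ≈⟨ PS.*-cong (PS.*-congˡ {P₁} (numer-shift (e + 2 * a) m)) (invₚ-cong (PS.sym denominators)) ⟩
  (P₁ ⊗ (x ⊗ numer (e + 2 * a) m)) ⊗ invₚ D
    ≈⟨ PS.*-congʳ {invₚ D} (x∙yz≈y∙xz P₁ x (numer (e + 2 * a) m)) ⟩
  (x ⊗ (P₁ ⊗ numer (e + 2 * a) m)) ⊗ invₚ D
    ≈⟨ PS.*-congʳ {invₚ D} (PS.*-congˡ {x} (PS.sym (numer-split e a m))) ⟩
  (x ⊗ numer e (a + m)) ⊗ invₚ D
    ≈⟨ xy∙z≈yz∙x x (numer e (a + m)) (invₚ D) ⟩
  factorₚ e (a + m) ⊗ x
    ∎
  where
  P₁ = numer e a
  D₁ = denom e (suc a)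
  P₂ = numer (e + 2 * a + 2) m
  D₂ = denom (e + 2 * a + 2) m
  D = denom e (suc (a + m))
  x = q^ (2 * m)
  exponent : ∀ e a → e + 2 * suc a ≡ e + 2 * a + 2
  exponent = solve-∀
  denominators : D ≋ D₁ ⊗ D₂
  denominators = PS.trans (denom-split e (suc a) m) (PS.*-congˡ {D₁} (PS.reflexive (cong (λ d → denom d m) (exponent e a))))

-- The summand with o added to every exponent offset K_j + M_{j-1}.
offsetSummand : ∀ {n} → ℕ → Vec ℕ n → Vec ℕ n → PS
offsetSummand o []       []       = oneₚ
offsetSummand o (m ∷ ms) (k ∷ ks) = factorₚ (o + 2 * k) m ⊗ offsetSummand (o + 2 * k + 2 * m) ms ks

Positive : ∀ {n} → Vec ℕ n → Set
Positive ms = ∀ i → 1 ≤ lookup ms i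

Ord≥-offsetSummand : ∀ {n} o (ms ks : Vec ℕ n) → Positive ms → Ord≥ (total ks) (offsetSummand o ms ks)
Ord≥-offsetSummand o []           []       pos = λ _ ()
Ord≥-offsetSummand o (zero  ∷ ms) (k ∷ ks) pos with () ← pos Fin.zero
Ord≥-offsetSummand o (suc m ∷ ms) (k ∷ ks) pos =
  Ord≥-⊗ (Ord≥-≤ (k≤c+2k+2 o k) (Ord≥-factorₚ (o + 2 * k) m)) (Ord≥-offsetSummand _ ms ks (pos ∘ Fin.suc))

geometricProduct : ∀ {n} → Vec ℕ n → PS
geometricProduct {n} ms = ∏ₚ (List.tabulate (λ (j : Fin n) → geometric (suffix ms (toℕ j))))

mutual
  iterSum-offsetSummand : ∀ {n} c m (ms : Vec ℕ n) → Positive (m ∷ ms) →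
    iterSum (suc n) (offsetSummand c (m ∷ ms))
      ≋ (antidifference (c + 2) (m + total ms) ⊘ (oneₚ ⊖ q^ (2 * (m + total ms)))) ⊗ geometricProduct ms
  iterSum-offsetSummand c zero    ms pos with () ← pos Fin.zero
  iterSum-offsetSummand {n} c (suc m) ms pos = begin
    iterSum (suc n) (offsetSummand c (suc m ∷ ms))
      ≈⟨ iterSum-peel n (offsetSummand c (suc m ∷ ms)) ⟩
    sumPos (λ k → iterSum n (λ ks → F k ⊗ R k ks))
      ≈⟨ sumPos-cong (λ k → iterSum n (λ ks → F k ⊗ R k ks)) (λ k → F k ⊗ iterSum n (R k))
           (λ k → iterSum-⊗ˡ n (F (suc k)) (R (suc k)) (λ ks → Ord≥-offsetSummand _ ms ks (pos ∘ Fin.suc))) ⟩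
    sumPos (λ k → F k ⊗ iterSum n (R k))
      ≈⟨ sumPos-cong (λ k → F k ⊗ iterSum n (R k)) (λ k → factorₚ (c + 2 * k) M ⊗ G)
           (λ k → factorₚ-⊗-iterSum (c + 2 * suc k) (suc m) ms (pos ∘ Fin.suc)) ⟩
    sumPos (λ k → factorₚ (c + 2 * k) M ⊗ G)
      ≈⟨ sumPos-⊗ʳ (λ k → factorₚ (c + 2 * k) M) G
           (λ k → Ord≥-≤ (k≤c+2k+2 c (suc k)) (Ord≥-factorₚ (c + 2 * suc k) (m + total ms))) ⟩
    sumPos (λ k → factorₚ (c + 2 * k) M) ⊗ G
      ≈⟨ PS.*-congʳ {G} (sumPos-factorₚ c (m + total ms)) ⟩
    (antidifference (c + 2) M ⊘ (oneₚ ⊖ q^ (2 * M))) ⊗ G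
      ∎
    where
    M = suc m + total ms
    G = geometricProduct ms
    F : ℕ → PS
    F k = factorₚ (c + 2 * k) (suc m)
    R : ℕ → Vec ℕ n → PS
    R k = offsetSummand (c + 2 * k + 2 * suc m) ms

  factorₚ-⊗-iterSum : ∀ {n} e a (ms : Vec ℕ n) → Positive ms →
    factorₚ e a ⊗ iterSum n (offsetSummand (e + 2 * a) ms) ≋ factorₚ e (a + total ms) ⊗ geometricProduct ms
  factorₚ-⊗-iterSum e a []       pos = PS.*-congʳ {oneₚ} (PS.reflexive (cong (factorₚ e) (≡.sym (ℕP.+-identityʳ a))))
  factorₚ-⊗-iterSum e a (m ∷ ms) pos = begin
    F ⊗ iterSum _ (offsetSummand (e + 2 * a) (m ∷ ms))
      ≈⟨ PS.*-congˡ {F} (iterSum-offsetSummand (e + 2 * a) m ms pos) ⟩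
    F ⊗ ((A ⊗ invₚ Q) ⊗ G)
      ≈⟨ PS.*-congˡ {F} (PS.*-assoc A (invₚ Q) G) ⟩
    F ⊗ (A ⊗ (invₚ Q ⊗ G))
      ≈⟨ PS.sym (PS.*-assoc F A (invₚ Q ⊗ G)) ⟩
    (F ⊗ A) ⊗ (invₚ Q ⊗ G)
      ≈⟨ PS.*-congʳ {invₚ Q ⊗ G} (factorₚ-⊗-antidifference e a M) ⟩
    (factorₚ e (a + M) ⊗ q^ (2 * M)) ⊗ (invₚ Q ⊗ G)
      ≈⟨ PS.*-assoc (factorₚ e (a + M)) (q^ (2 * M)) (invₚ Q ⊗ G) ⟩
    factorₚ e (a + M) ⊗ (q^ (2 * M) ⊗ (invₚ Q ⊗ G))
      ≈⟨ PS.*-congˡ {factorₚ e (a + M)} (PS.sym (PS.*-assoc (q^ (2 * M)) (invₚ Q) G)) ⟩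
    factorₚ e (a + M) ⊗ (geometric M ⊗ G)
      ∎
    where
    M = m + total ms
    F = factorₚ e a
    A = antidifference (e + 2 * a + 2) M
    Q = oneₚ ⊖ q^ (2 * M)
    G = geometricProduct ms

map-toList-tabulate : ∀ {n} {A B : Set} (h : A → B) (g : Fin n → A) →
  List.map h (toList (tabulate g)) ≡ List.tabulate (h ∘ g)
map-toList-tabulate {zero}  h g = refl
map-toList-tabulate {suc n} h g = cong (h (g Fin.zero) List.∷_) (map-toList-tabulate h (g ∘ Fin.suc))

∏ₚ-from1 : ∀ h m → ∏ₚ (List.map h (from1 m)) ≡ ∏ m (h ∘ suc)
∏ₚ-from1 h m = ≡.trans (cong ∏ₚ (≡.sym (LP.map-∘ (List.upTo m)))) (∏.foldr-map-applyUpTo (h ∘ suc) id m)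

∏ₚ-from0 : ∀ h m → ∏ₚ (List.map h (from0 m)) ≡ ∏ (suc m) h
∏ₚ-from0 h m = ∏.foldr-map-applyUpTo h id (suc m)

factor≡factorₚ : ∀ {n} (ms ks : Vec ℕ n) j →
  factor ms ks j ≡ factorₚ (2 * prefix ks (suc (toℕ j)) + 2 * prefix ms (toℕ j)) (lookup ms j)
factor≡factorₚ ms ks j =
  cong₂ _⊘_ (∏ₚ-from1 (λ i → q^ (e + 2 * i)) (lookup ms j)) (∏ₚ-from0 (λ i → oneₚ ⊕ q^ (e + 2 * i + 1)) (lookup ms j))
  where e = 2 * prefix ks (suc (toℕ j)) + 2 * prefix ms (toℕ j)

∏ₚ-tabulate-offset : ∀ {n} o (ms ks : Vec ℕ n) →
  ∏ₚ (List.tabulate (λ j → factorₚ (o + (2 * prefix ks (suc (toℕ j)) + 2 * prefix ms (toℕ j))) (lookup ms j)))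
    ≋ offsetSummand o ms ks
∏ₚ-tabulate-offset o []       []       = PS.refl
∏ₚ-tabulate-offset o (m ∷ ms) (k ∷ ks) = PS.*-cong
  (PS.reflexive (cong (λ e → factorₚ e m) (exponent₀ o k)))
  (PS.trans (PS.reflexive (cong ∏ₚ (LP.tabulate-cong (λ j → cong (λ e → factorₚ e (lookup ms j))
                                                            (exponent o k m (prefix ks (suc (toℕ j))) (prefix ms (toℕ j)))))))
            (∏ₚ-tabulate-offset (o + 2 * k + 2 * m) ms ks))
  where
  exponent₀ : ∀ o k → o + (2 * (k + 0) + 2 * 0) ≡ o + 2 * k
  exponent₀ = solve-∀
  exponent : ∀ o k m K M → o + (2 * (k + K) + 2 * (m + M)) ≡ o + 2 * k + 2 * m + (2 * K + 2 * M)
  exponent = solve-∀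

summand≋offsetSummand : ∀ {n} (ms ks : Vec ℕ n) → summand ms ks ≋ offsetSummand 0 ms ks
summand≋offsetSummand ms ks = PS.trans
  (PS.reflexive (≡.trans (cong ∏ₚ (map-toList-tabulate (factor ms ks) id))
                         (cong ∏ₚ (LP.tabulate-cong (factor≡factorₚ ms ks)))))
  (∏ₚ-tabulate-offset 0 ms ks)

prefix-total : ∀ {n} (ms : Vec ℕ n) → prefix ms n ≡ total ms
prefix-total ms = cong ListAction.sum (take-toList ms)
  where
  take-toList : ∀ {n} (v : Vec ℕ n) → take n (toList v) ≡ toList v
  take-toList []       = refl
  take-toList (x ∷ xs) = cong (x List.∷_) (take-toList xs)

RHS≋ : ∀ {n} m (ms : Vec ℕ n) →
  RHS (suc n) (m ∷ ms) ≋ (numer 0 (m + total ms) ⊘ denom 2 (m + total ms)) ⊗ geometricProduct (m ∷ ms)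
RHS≋ {n} m ms = begin
  RHS (suc n) (m ∷ ms)
    ≡⟨ cong₂ (λ A B → (A ⊘ B) ⊗ C) (∏ₚ-from1 (λ i → q^ (2 * i)) M′)
                                   (∏ₚ-from1 (λ i → oneₚ ⊕ q^ (2 * i + 1)) M′) ⟩
  (numer 0 M′ ⊘ ∏ M′ (λ i → oneₚ ⊕ q^ (2 * suc i + 1))) ⊗ C
    ≈⟨ PS.*-congʳ {C} (PS.*-congˡ {numer 0 M′} (invₚ-cong
         (∏.big-cong M′ (λ i → PS.reflexive (cong (λ d → oneₚ ⊕ q^ d) (exponent i)))))) ⟩
  (numer 0 M′ ⊘ denom 2 M′) ⊗ C
    ≡⟨ cong₂ (λ M C′ → (numer 0 M ⊘ denom 2 M) ⊗ C′) (prefix-total (m ∷ ms))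
                                                    (cong ∏ₚ (map-toList-tabulate {suc n} c id)) ⟩
  (numer 0 (m + total ms) ⊘ denom 2 (m + total ms)) ⊗ geometricProduct (m ∷ ms)
    ∎
  where
  M′ = prefix (m ∷ ms) (suc n)
  c : Fin (suc n) → PS
  c j = geometric (suffix (m ∷ ms) (toℕ j))
  C = ∏ₚ (List.map c (toList (Vec.allFin (suc n))))
  exponent : ∀ i → 2 * suc i + 1 ≡ 2 + 2 * i + 1
  exponent = solve-∀

antidifference-2 : ∀ M → antidifference 2 M ⊘ (oneₚ ⊖ q^ (2 * M)) ≋ (numer 0 M ⊘ denom 2 M) ⊗ geometric M
antidifference-2 M = begin
  (numer 2 M ⊗ I) ⊗ J          ≈⟨ PS.*-congʳ {J} (PS.*-congʳ {I} (numer-shift 0 M)) ⟩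
  ((x ⊗ numer 0 M) ⊗ I) ⊗ J    ≈⟨ PS.*-congʳ {J} (xy∙z≈yz∙x x (numer 0 M) I) ⟩
  ((numer 0 M ⊗ I) ⊗ x) ⊗ J    ≈⟨ PS.*-assoc (numer 0 M ⊗ I) x J ⟩
  (numer 0 M ⊗ I) ⊗ (x ⊗ J)    ∎
  where
  x = q^ (2 * M)
  I = invₚ (denom 2 M)
  J = invₚ (oneₚ ⊖ x)

lemma5p4 : (n : ℕ) → 1 ≤ n → (ms : Vec ℕ n) → (∀ i → 1 ≤ lookup ms i) →
    LHS n ms ≈ₚ RHS n ms
lemma5p4 zero    ()
lemma5p4 (suc n) _  (m ∷ ms) pos = coeff (begin
  LHS (suc n) (m ∷ ms)
    ≈⟨ iterSum-cong (suc n) (summand (m ∷ ms)) (offsetSummand 0 (m ∷ ms)) (summand≋offsetSummand (m ∷ ms)) ⟩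
  iterSum (suc n) (offsetSummand 0 (m ∷ ms))
    ≈⟨ iterSum-offsetSummand 0 m ms pos ⟩
  (antidifference 2 M ⊘ (oneₚ ⊖ q^ (2 * M))) ⊗ G
    ≈⟨ PS.*-congʳ {G} (antidifference-2 M) ⟩
  ((numer 0 M ⊘ denom 2 M) ⊗ geometric M) ⊗ G
    ≈⟨ PS.*-assoc (numer 0 M ⊘ denom 2 M) (geometric M) G ⟩
  (numer 0 M ⊘ denom 2 M) ⊗ (geometric M ⊗ G)
    ≈⟨ PS.sym (RHS≋ m ms) ⟩
  RHS (suc n) (m ∷ ms)
    ∎)
  where
  M = m + total ms
  G = geometricProduct ms
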